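{- The reductions $\longrightarrow_{\beta_c,\mathit{id}}$ and $\longrightarrow_{\mathit{ass}}$ commute: for all computations $M,N,L$, if $M\longrightarrow^*_{\beta_c,\mathit{id}}N$ and $M\longrightarrow^*_{\mathit{ass}}L$, then there is a computation $P$ with $N\longrightarrow^*_{\mathit{ass}}P$ and $L\longrightarrow^*_{\beta_c,\mathit{id}}P$.
   Context: Syntax of $\lambda_c^u$: values $V ::= x\mid \lambda x.M$, computations $M ::= \mathit{unit}\,V\mid M\star V$ (up to renaming of bound variables; $M[V/x]$ capture-avoiding substitution). $\beta_c=\{(\mathit{unit}\,V\star(\lambda x.M),M[V/x])\}$, $\mathit{id}=\{(M\star\lambda x.\mathit{unit}\,x,M)\}$, $\mathit{ass}=\{((L\star\lambda x.M)\star\lambda y.N,\ L\star\lambda x.(M\star\lambda y.N))\mid x\notin FV(N)\}$. For a notion of reduction $R$, $\longrightarrow_R$ is its compatible closure: if $(M,M')\in R$ then $\mathcal C[M]\longrightarrow_R\mathcal C[M']$ for every computation context, where value contexts are $\mathcal V ::= [\cdot]\mid\lambda x.\mathcal C$ and computation contexts $\mathcal C ::= [\cdot]\mid\mathit{unit}\,\mathcal V\mid\mathcal C\star V\mid M\star\mathcal V$. $\longrightarrow_{\beta_c,\mathit{id}}$ is $\longrightarrow_{\beta_c\cup\mathit{id}}$; starred arrows denote reflexive–transitive closures. -}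

module Defs where

open import Data.Nat using (ℕ; zero; suc)
open import Data.Fin using (Fin; zero; suc)
open import Data.Sum using (_⊎_)
open import Relation.Binary.Construct.Closure.ReflexiveTransitive using (Star)

-- Well-scoped de Bruijn syntax of λ_c^u (terms up to α-renaming).
-- Val n / Comp n : values / computations with at most n free variables.
mutual
  data Val (n : ℕ) : Set where
    var : Fin n → Val n
    lam : Comp (suc n) → Val n

  data Comp (n : ℕ) : Set where
    unit : Val n → Comp n
    _⋆_  : Comp n → Val n → Comp n

infixl 5 _⋆_

Ren : ℕ → ℕ → Set
Ren m n = Fin m → Fin n

liftR : ∀ {m n} → Ren m n → Ren (suc m) (suc n)
liftR ρ zero    = zero
liftR ρ (suc i) = suc (ρ i)

mutual
  renV : ∀ {m n} → Ren m n → Val m → Val n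
  renV ρ (var x) = var (ρ x)
  renV ρ (lam M) = lam (renC (liftR ρ) M)

  renC : ∀ {m n} → Ren m n → Comp m → Comp n
  renC ρ (unit V)  = unit (renV ρ V)
  renC ρ (M ⋆ V)   = renC ρ M ⋆ renV ρ V

Sub : ℕ → ℕ → Set
Sub m n = Fin m → Val n

liftS : ∀ {m n} → Sub m n → Sub (suc m) (suc n)
liftS σ zero    = var zero
liftS σ (suc i) = renV suc (σ i)

mutual
  subV : ∀ {m n} → Sub m n → Val m → Val n
  subV σ (var x) = σ x
  subV σ (lam M) = lam (subC (liftS σ) M)

  subC : ∀ {m n} → Sub m n → Comp m → Comp n
  subC σ (unit V) = unit (subV σ V)
  subC σ (M ⋆ V)  = subC σ M ⋆ subV σ V

single : ∀ {n} → Val n → Sub (suc n) n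
single V zero    = V
single V (suc i) = var i

_[_] : ∀ {n} → Comp (suc n) → Val n → Comp n
M [ V ] = subC (single V) M

Rel : Set₁
Rel = ∀ {n} → Comp n → Comp n → Set

data βc : Rel where
  βc-rule : ∀ {n} (V : Val n) (M : Comp (suc n)) → βc (unit V ⋆ lam M) (M [ V ])

data idR : Rel where
  id-rule : ∀ {n} (M : Comp n) → idR (M ⋆ lam (unit (var zero))) M

-- ass : (L ⋆ λx.M) ⋆ λy.N  ↦  L ⋆ λx.(M ⋆ λy.N)   with x ∉ FV(N).
-- In de Bruijn form N lives in scope (y, outer); on the right it is placed under
-- both x and y, so it is weakened past x (the side condition x ∉ FV(N)).
weakUnder1 : ∀ {n} → Ren (suc n) (suc (suc n))
weakUnder1 = liftR suc

data ass : Rel where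
  ass-rule : ∀ {n} (L : Comp n) (M : Comp (suc n)) (N : Comp (suc n)) →
    ass ((L ⋆ lam M) ⋆ lam N) (L ⋆ lam (M ⋆ lam (renC weakUnder1 N)))

_∪_ : Rel → Rel → Rel
(R ∪ S) M N = R M N ⊎ S M N

-- Compatible closure over value contexts 𝒱 ::= [·] | λx.𝒞 and computation
-- contexts 𝒞 ::= [·] | unit 𝒱 | 𝒞 ⋆ V | M ⋆ 𝒱 (the hole is a computation).
mutual
  data StepC (R : Rel) : ∀ {n} → Comp n → Comp n → Set where
    root  : ∀ {n} {M M' : Comp n} → R M M' → StepC R M M'
    unitC : ∀ {n} {V V' : Val n} → StepV R V V' → StepC R (unit V) (unit V')
    ⋆ₗ    : ∀ {n} {M M' : Comp n} {V} → StepC R M M' → StepC R (M ⋆ V) (M' ⋆ V)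
    ⋆ᵣ    : ∀ {n} {M : Comp n} {V V'} → StepV R V V' → StepC R (M ⋆ V) (M ⋆ V')

  data StepV (R : Rel) : ∀ {n} → Val n → Val n → Set where
    lamC : ∀ {n} {M M' : Comp (suc n)} → StepC R M M' → StepV R (lam M) (lam M')

_⟶[_]_ : ∀ {n} → Comp n → Rel → Comp n → Set
M ⟶[ R ] N = StepC R M N

_⟶*[_]_ : ∀ {n} → Comp n → Rel → Comp n → Set
M ⟶*[ R ] N = Star (StepC R) M N

module Submission where

open import Defs
open import Level using (Level; _⊔_)
open import Data.Nat using (ℕ; suc)
open import Data.Fin using (zero; suc)
open import Data.Product using (Σ; ∃; _×_; _,_)
open import Data.Sum using (inj₁; inj₂)
open import Function using (_∘_; id)
open import Relation.Binary.PropositionalEquality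
  using (_≡_; _≗_; refl; sym; trans; cong; cong₂; subst; subst₂)
open import Relation.Binary.Construct.Closure.ReflexiveTransitive
  using (Star; ε; _◅_; _◅◅_; gmap; return)
open import Relation.Binary.Construct.Closure.Reflexive
  using (ReflClosure) renaming (refl to stay; [_] to one; map to reflMap)

-- By Hindley's strip argument it suffices to join one (βc ∪ id)-step and one
-- ass-step out of a common term by ass-steps on one side and AT MOST ONE
-- (βc ∪ id)-step on the other. Non-overlapping redexes join because both notions
-- are stable under substitution; an ass-step inside the argument V of a βc-redex
-- becomes several ass-steps of M[V/x], which is why that side needs ⟶*. The three
-- overlaps (βc or id at the inner bind of an ass-redex, id at its outer bind)
-- join with a single βc- or id-step.

module _ {a r s : Level} {A : Set a} where

  LocalCommutation : (R : A → A → Set r) (S : A → A → Set s) → Set (a ⊔ r ⊔ s)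
  LocalCommutation R S =
    ∀ {x y z} → R x y → S x z → ∃ λ w → Star S y w × ReflClosure R z w

  module _ {R : A → A → Set r} {S : A → A → Set s} (local : LocalCommutation R S) where

    strip : ∀ {x y z} → R x y → Star S x z → ∃ λ w → Star S y w × ReflClosure R z w
    strip r ε = _ , ε , one r
    strip r (s ◅ ss) with local r s
    ... | _ , ss₁ , stay  = _ , ss₁ ◅◅ ss , stay
    ... | _ , ss₁ , one r₁ with strip r₁ ss
    ...   | w , ss₂ , r₂ = w , ss₁ ◅◅ ss₂ , r₂

    star-commute : ∀ {x y z} → Star R x y → Star S x z → ∃ λ w → Star S y w × Star R z w
    star-commute ε ss = _ , ss , ε
    star-commute (r ◅ rs) ss with strip r ss
    ... | _ , ss₁ , stay  = star-commute rs ss₁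
    ... | _ , ss₁ , one r₁ with star-commute rs ss₁
    ...   | w , ss₂ , rs₂ = w , ss₂ , r₁ ◅ rs₂

liftR-∘ : ∀ {l m n} {ρ : Ren m n} {ρ′ : Ren l m} {ρ″ : Ren l n} →
  ρ ∘ ρ′ ≗ ρ″ → liftR ρ ∘ liftR ρ′ ≗ liftR ρ″
liftR-∘ p zero    = refl
liftR-∘ p (suc i) = cong suc (p i)

mutual
  renV-renV : ∀ {l m n} {ρ : Ren m n} {ρ′ : Ren l m} {ρ″ : Ren l n} →
    ρ ∘ ρ′ ≗ ρ″ → renV ρ ∘ renV ρ′ ≗ renV ρ″
  renV-renV p (var x) = cong var (p x)
  renV-renV p (lam M) = cong lam (renC-renC (liftR-∘ p) M)

  renC-renC : ∀ {l m n} {ρ : Ren m n} {ρ′ : Ren l m} {ρ″ : Ren l n} →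
    ρ ∘ ρ′ ≗ ρ″ → renC ρ ∘ renC ρ′ ≗ renC ρ″
  renC-renC p (unit V) = cong unit (renV-renV p V)
  renC-renC p (M ⋆ V)  = cong₂ _⋆_ (renC-renC p M) (renV-renV p V)

liftS-liftR : ∀ {l m n} {σ : Sub m n} {ρ : Ren l m} {τ : Sub l n} →
  σ ∘ ρ ≗ τ → liftS σ ∘ liftR ρ ≗ liftS τ
liftS-liftR p zero    = refl
liftS-liftR p (suc i) = cong (renV suc) (p i)

mutual
  subV-renV : ∀ {l m n} {σ : Sub m n} {ρ : Ren l m} {τ : Sub l n} →
    σ ∘ ρ ≗ τ → subV σ ∘ renV ρ ≗ subV τ
  subV-renV p (var x) = p x
  subV-renV p (lam M) = cong lam (subC-renC (liftS-liftR p) M)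

  subC-renC : ∀ {l m n} {σ : Sub m n} {ρ : Ren l m} {τ : Sub l n} →
    σ ∘ ρ ≗ τ → subC σ ∘ renC ρ ≗ subC τ
  subC-renC p (unit V) = cong unit (subV-renV p V)
  subC-renC p (M ⋆ V)  = cong₂ _⋆_ (subC-renC p M) (subV-renV p V)

renV-suc-comm : ∀ {m n} (ρ : Ren m n) (V : Val m) →
  renV (liftR ρ) (renV suc V) ≡ renV suc (renV ρ V)
renV-suc-comm ρ V = trans (renV-renV (λ _ → refl) V) (sym (renV-renV (λ _ → refl) V))

liftR-liftS : ∀ {l m n} {ρ : Ren m n} {σ : Sub l m} {τ : Sub l n} →
  renV ρ ∘ σ ≗ τ → renV (liftR ρ) ∘ liftS σ ≗ liftS τ
liftR-liftS p zero            = refl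
liftR-liftS {ρ = ρ} {σ} p (suc i) = trans (renV-suc-comm ρ (σ i)) (cong (renV suc) (p i))

mutual
  renV-subV : ∀ {l m n} {ρ : Ren m n} {σ : Sub l m} {τ : Sub l n} →
    renV ρ ∘ σ ≗ τ → renV ρ ∘ subV σ ≗ subV τ
  renV-subV p (var x) = p x
  renV-subV p (lam M) = cong lam (renC-subC (liftR-liftS p) M)

  renC-subC : ∀ {l m n} {ρ : Ren m n} {σ : Sub l m} {τ : Sub l n} →
    renV ρ ∘ σ ≗ τ → renC ρ ∘ subC σ ≗ subC τ
  renC-subC p (unit V) = cong unit (renV-subV p V)
  renC-subC p (M ⋆ V)  = cong₂ _⋆_ (renC-subC p M) (renV-subV p V)

subV-suc-comm : ∀ {m n} (σ : Sub m n) (V : Val m) →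
  subV (liftS σ) (renV suc V) ≡ renV suc (subV σ V)
subV-suc-comm σ V = trans (subV-renV (λ _ → refl) V) (sym (renV-subV (λ _ → refl) V))

liftS-liftS : ∀ {l m n} {σ : Sub m n} {τ : Sub l m} {υ : Sub l n} →
  subV σ ∘ τ ≗ υ → subV (liftS σ) ∘ liftS τ ≗ liftS υ
liftS-liftS p zero            = refl
liftS-liftS {σ = σ} {τ} p (suc i) = trans (subV-suc-comm σ (τ i)) (cong (renV suc) (p i))

mutual
  subV-subV : ∀ {l m n} {σ : Sub m n} {τ : Sub l m} {υ : Sub l n} →
    subV σ ∘ τ ≗ υ → subV σ ∘ subV τ ≗ subV υ
  subV-subV p (var x) = p x
  subV-subV p (lam M) = cong lam (subC-subC (liftS-liftS p) M)

  subC-subC : ∀ {l m n} {σ : Sub m n} {τ : Sub l m} {υ : Sub l n} →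
    subV σ ∘ τ ≗ υ → subC σ ∘ subC τ ≗ subC υ
  subC-subC p (unit V) = cong unit (subV-subV p V)
  subC-subC p (M ⋆ V)  = cong₂ _⋆_ (subC-subC p M) (subV-subV p V)

liftS-var : ∀ {n} {σ : Sub n n} → σ ≗ var → liftS σ ≗ var
liftS-var p zero    = refl
liftS-var p (suc i) = cong (renV suc) (p i)

mutual
  subV-id : ∀ {n} {σ : Sub n n} → σ ≗ var → subV σ ≗ id
  subV-id p (var x) = p x
  subV-id p (lam M) = cong lam (subC-id (liftS-var p) M)

  subC-id : ∀ {n} {σ : Sub n n} → σ ≗ var → subC σ ≗ id
  subC-id p (unit V) = cong unit (subV-id p V)
  subC-id p (M ⋆ V)  = cong₂ _⋆_ (subC-id p M) (subV-id p V)

liftR-as-liftS : ∀ {m n} {ρ : Ren m n} {σ : Sub m n} →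
  var ∘ ρ ≗ σ → var ∘ liftR ρ ≗ liftS σ
liftR-as-liftS p zero    = refl
liftR-as-liftS p (suc i) = cong (renV suc) (p i)

mutual
  renV-as-subV : ∀ {m n} {ρ : Ren m n} {σ : Sub m n} → var ∘ ρ ≗ σ → renV ρ ≗ subV σ
  renV-as-subV p (var x) = p x
  renV-as-subV p (lam M) = cong lam (renC-as-subC (liftR-as-liftS p) M)

  renC-as-subC : ∀ {m n} {ρ : Ren m n} {σ : Sub m n} → var ∘ ρ ≗ σ → renC ρ ≗ subC σ
  renC-as-subC p (unit V) = cong unit (renV-as-subV p V)
  renC-as-subC p (M ⋆ V)  = cong₂ _⋆_ (renC-as-subC p M) (renV-as-subV p V)

subV-renV-cancel : ∀ {m n} {σ : Sub n m} {ρ : Ren m n} → σ ∘ ρ ≗ var → subV σ ∘ renV ρ ≗ id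
subV-renV-cancel p V = trans (subV-renV p V) (subV-id (λ _ → refl) V)

subC-renC-cancel : ∀ {m n} {σ : Sub n m} {ρ : Ren m n} → σ ∘ ρ ≗ var → subC σ ∘ renC ρ ≗ id
subC-renC-cancel p M = trans (subC-renC p M) (subC-id (λ _ → refl) M)

subC-[] : ∀ {m n} (σ : Sub m n) (M : Comp (suc m)) (V : Val m) →
  subC σ (M [ V ]) ≡ (subC (liftS σ) M) [ subV σ V ]
subC-[] σ M V = trans (subC-subC (λ _ → refl) M) (sym (subC-subC single-liftS M))
  where
    single-liftS : subV (single (subV σ V)) ∘ liftS σ ≗ subV σ ∘ single V
    single-liftS zero    = refl
    single-liftS (suc i) = subV-renV-cancel (λ _ → refl) (σ i)

subC-weakUnder1 : ∀ {m n} (σ : Sub m n) (N : Comp (suc m)) →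
  subC (liftS (liftS σ)) (renC weakUnder1 N) ≡ renC weakUnder1 (subC (liftS σ) N)
subC-weakUnder1 σ N = trans (subC-renC lift²-weakUnder1 N) (sym (renC-subC (λ _ → refl) N))
  where
    lift²-weakUnder1 : liftS (liftS σ) ∘ weakUnder1 ≗ renV weakUnder1 ∘ liftS σ
    lift²-weakUnder1 zero    = refl
    lift²-weakUnder1 (suc i) = sym (renV-suc-comm suc (σ i))

Stable : Rel → Set
Stable R = ∀ {m n} (σ : Sub m n) {M M′ : Comp m} → R M M′ → R (subC σ M) (subC σ M′)

∪-stable : ∀ {R S : Rel} → Stable R → Stable S → Stable (R ∪ S)
∪-stable stR stS σ (inj₁ r) = inj₁ (stR σ r)
∪-stable stR stS σ (inj₂ s) = inj₂ (stS σ s)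

βc-stable : Stable βc
βc-stable σ (βc-rule V M) =
  subst (βc _) (sym (subC-[] σ M V)) (βc-rule (subV σ V) (subC (liftS σ) M))

idR-stable : Stable idR
idR-stable σ (id-rule M) = id-rule (subC σ M)

ass-stable : Stable ass
ass-stable σ (ass-rule L M N) =
  subst (λ N′ → ass (subC σ ((L ⋆ lam M) ⋆ lam N)) (subC σ L ⋆ lam (subC (liftS σ) M ⋆ lam N′)))
        (sym (subC-weakUnder1 σ N))
        (ass-rule (subC σ L) (subC (liftS σ) M) (subC (liftS σ) N))

module _ {R : Rel} (stable : Stable R) where

  mutual
    subC-step : ∀ {m n} (σ : Sub m n) {M M′ : Comp m} →
      M ⟶[ R ] M′ → subC σ M ⟶[ R ] subC σ M′
    subC-step σ (root r)  = root (stable σ r)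
    subC-step σ (unitC s) = unitC (subV-step σ s)
    subC-step σ (⋆ₗ s)    = ⋆ₗ (subC-step σ s)
    subC-step σ (⋆ᵣ s)    = ⋆ᵣ (subV-step σ s)

    subV-step : ∀ {m n} (σ : Sub m n) {V V′ : Val m} →
      StepV R V V′ → StepV R (subV σ V) (subV σ V′)
    subV-step σ (lamC s) = lamC (subC-step (liftS σ) s)

  renC-step : ∀ {m n} (ρ : Ren m n) {M M′ : Comp m} →
    M ⟶[ R ] M′ → renC ρ M ⟶[ R ] renC ρ M′
  renC-step ρ {M} {M′} s =
    subst₂ (StepC R) (sym (renC-as-subC (λ _ → refl) M)) (sym (renC-as-subC (λ _ → refl) M′))
      (subC-step (var ∘ ρ) s)

  renV-step : ∀ {m n} (ρ : Ren m n) {V V′ : Val m} →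
    StepV R V V′ → StepV R (renV ρ V) (renV ρ V′)
  renV-step ρ (lamC s) = lamC (renC-step (liftR ρ) s)

  liftS-steps : ∀ {m n} {σ σ′ : Sub m n} →
    (∀ i → Star (StepV R) (σ i) (σ′ i)) → ∀ i → Star (StepV R) (liftS σ i) (liftS σ′ i)
  liftS-steps ss zero    = ε
  liftS-steps ss (suc i) = gmap (renV suc) (renV-step suc) (ss i)

  mutual
    subC-steps : ∀ {m n} {σ σ′ : Sub m n} →
      (∀ i → Star (StepV R) (σ i) (σ′ i)) → ∀ M → subC σ M ⟶*[ R ] subC σ′ M
    subC-steps ss (unit V) = gmap unit unitC (subV-steps ss V)
    subC-steps {σ = σ} {σ′} ss (M ⋆ V) =
      gmap (_⋆ subV σ V) ⋆ₗ (subC-steps ss M) ◅◅ gmap (subC σ′ M ⋆_) ⋆ᵣ (subV-steps ss V)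

    subV-steps : ∀ {m n} {σ σ′ : Sub m n} →
      (∀ i → Star (StepV R) (σ i) (σ′ i)) → ∀ V → Star (StepV R) (subV σ V) (subV σ′ V)
    subV-steps ss (var x) = ss x
    subV-steps ss (lam M) = gmap lam lamC (subC-steps (liftS-steps ss) M)

  []-steps : ∀ {n} {V V′ : Val n} → StepV R V V′ → ∀ M → (M [ V ]) ⟶*[ R ] (M [ V′ ])
  []-steps s = subC-steps single-steps
    where
      single-steps : ∀ i → Star (StepV R) (single _ i) (single _ i)
      single-steps zero    = return s
      single-steps (suc i) = ε

βc∪idR-stable : Stable (βc ∪ idR)
βc∪idR-stable = ∪-stable βc-stable idR-stable

ass-βc-join : ∀ {n} (W : Val n) (M : Comp (suc n)) (N : Comp (suc n)) →
  (unit W ⋆ lam (M ⋆ lam (renC weakUnder1 N))) ⟶[ βc ∪ idR ] ((M [ W ]) ⋆ lam N)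
ass-βc-join W M N =
  subst (λ N′ → (unit W ⋆ lam (M ⋆ lam (renC weakUnder1 N))) ⟶[ βc ∪ idR ] ((M [ W ]) ⋆ lam N′))
        (subC-renC-cancel {ρ = weakUnder1} liftS-single-weakUnder1 N)
    (root (inj₁ (βc-rule W (M ⋆ lam (renC weakUnder1 N)))))
  where
    liftS-single-weakUnder1 : liftS (single W) ∘ weakUnder1 ≗ var
    liftS-single-weakUnder1 zero    = refl
    liftS-single-weakUnder1 (suc i) = refl

ass-id-join : ∀ {n} (L : Comp n) (N : Comp (suc n)) →
  (L ⋆ lam (unit (var zero) ⋆ lam (renC weakUnder1 N))) ⟶[ βc ∪ idR ] (L ⋆ lam N)
ass-id-join L N =
  ⋆ᵣ (lamC (subst ((unit (var zero) ⋆ lam (renC weakUnder1 N)) ⟶[ βc ∪ idR ]_)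
               (subC-renC-cancel {ρ = weakUnder1} var0-weakUnder1 N)
               (root (inj₁ (βc-rule (var zero) (renC weakUnder1 N))))))
  where
    var0-weakUnder1 : single (var zero) ∘ weakUnder1 ≗ var
    var0-weakUnder1 zero    = refl
    var0-weakUnder1 (suc i) = refl

mutual
  βc∪idR-ass-local : ∀ {n} → LocalCommutation (StepC (βc ∪ idR) {n}) (StepC ass)
  βc∪idR-ass-local (root (inj₁ (βc-rule V M))) (root ())
  βc∪idR-ass-local (root (inj₁ (βc-rule V M))) (⋆ₗ (root ()))
  βc∪idR-ass-local (root (inj₁ (βc-rule V M))) (⋆ₗ (unitC s)) =
    _ , []-steps ass-stable s M , one (root (inj₁ (βc-rule _ M)))
  βc∪idR-ass-local (root (inj₁ (βc-rule V M))) (⋆ᵣ (lamC s)) =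
    _ , return (subC-step ass-stable (single V) s) , one (root (inj₁ (βc-rule V _)))
  βc∪idR-ass-local (root (inj₂ (id-rule _))) (root (ass-rule L M _)) =
    _ , ε , one (⋆ᵣ (lamC (root (inj₂ (id-rule M)))))
  βc∪idR-ass-local (root (inj₂ (id-rule M))) (⋆ₗ s) = _ , return s , one (root (inj₂ (id-rule _)))
  βc∪idR-ass-local (root (inj₂ (id-rule M))) (⋆ᵣ (lamC (root ())))
  βc∪idR-ass-local (root (inj₂ (id-rule M))) (⋆ᵣ (lamC (unitC ())))
  βc∪idR-ass-local (unitC a) (root ())
  βc∪idR-ass-local (unitC a) (unitC b) with βc∪idR-ass-local-val a b
  ... | _ , bs , a′ = _ , gmap unit unitC bs , reflMap unitC a′
  βc∪idR-ass-local (⋆ₗ (root (inj₁ (βc-rule W M)))) (root (ass-rule _ _ N)) =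
    _ , ε , one (ass-βc-join W M N)
  βc∪idR-ass-local (⋆ₗ (root (inj₂ (id-rule L)))) (root (ass-rule _ _ N)) =
    _ , ε , one (ass-id-join L N)
  βc∪idR-ass-local (⋆ₗ (⋆ₗ a)) (root (ass-rule _ _ _)) =
    _ , return (root (ass-rule _ _ _)) , one (⋆ₗ a)
  βc∪idR-ass-local (⋆ₗ (⋆ᵣ (lamC a))) (root (ass-rule _ _ _)) =
    _ , return (root (ass-rule _ _ _)) , one (⋆ᵣ (lamC (⋆ₗ a)))
  βc∪idR-ass-local (⋆ₗ {V = V} a) (⋆ₗ b) with βc∪idR-ass-local a b
  ... | _ , bs , a′ = _ , gmap (_⋆ V) ⋆ₗ bs , reflMap ⋆ₗ a′
  βc∪idR-ass-local (⋆ₗ a) (⋆ᵣ b) = _ , return (⋆ᵣ b) , one (⋆ₗ a)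
  βc∪idR-ass-local (⋆ᵣ (lamC a)) (root (ass-rule _ _ _)) =
    _ , return (root (ass-rule _ _ _)) ,
    one (⋆ᵣ (lamC (⋆ᵣ (lamC (renC-step βc∪idR-stable weakUnder1 a)))))
  βc∪idR-ass-local (⋆ᵣ a) (⋆ₗ b) = _ , return (⋆ₗ b) , one (⋆ᵣ a)
  βc∪idR-ass-local (⋆ᵣ {M = M} a) (⋆ᵣ b) with βc∪idR-ass-local-val a b
  ... | _ , bs , a′ = _ , gmap (M ⋆_) ⋆ᵣ bs , reflMap ⋆ᵣ a′

  βc∪idR-ass-local-val : ∀ {n} → LocalCommutation (StepV (βc ∪ idR) {n}) (StepV ass)
  βc∪idR-ass-local-val (lamC a) (lamC b) with βc∪idR-ass-local a b
  ... | _ , bs , a′ = _ , gmap lam lamC bs , reflMap lamC a′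

mainTheorem18 : ∀ {n : ℕ} (M N L : Comp n) →
    M ⟶*[ βc ∪ idR ] N → M ⟶*[ ass ] L →
    Σ (Comp n) (λ P → (N ⟶*[ ass ] P) × (L ⟶*[ βc ∪ idR ] P))
mainTheorem18 M N L = star-commute βc∪idR-ass-local
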